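{- Let $G=(V,E)$ be a complete graph with fixed vertices $s\neq t$, and let $x$ be a half-integral feasible solution of (L.P.1). Let $x=\sum_{i=1}^l\lambda_i\chi^{J_i}$ be a convex combination ($\lambda_i>0$, $\sum_i\lambda_i=1$) of incidence vectors of spanning trees $J_i$ of $G$, let $J$ be one of the trees $J_i$ (the randomly sampled tree), and let $T$ be the set of wrong degree vertices of $J$. Then $x(\delta(S))\ge2$ for every cut $S$ with $|S\cap T|$ odd.
   Context: (L.P.1): $x(\delta(s))=x(\delta(t))=1$; $x(\delta(v))=2$ for $v\neq s,t$; $x(\delta(S))\ge1$ for every $s$-$t$ cut $S$; $x(\delta(S))\ge2$ for every cut $S$ with $|S\cap\{s,t\}|$ even; $0\le x_e\le1$. A cut is $S$ with $\emptyset\subsetneq S\subsetneq V$; an $s$-$t$ cut has $|S\cap\{s,t\}|=1$. $\delta(S)$ is the set of edges with exactly one end in $S$; $x(D)=\sum_{e\in D}x_e$; $\chi^A$ is the incidence vector of edge set $A$. Half-integral means each $x_e\in\{0,\tfrac12,1\}$. The set of wrong degree vertices of a spanning tree $K$ is $\{v\in\{s,t\}:\deg_K(v)\text{ even}\}\cup\{v\notin\{s,t\}:\deg_K(v)\text{ odd}\}$.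
   Formalization: The coefficients λ_i of the convex combination of spanning-tree incidence vectors are rational. -}

module Defs where

open import Data.Bool using (Bool; true; false; if_then_else_; _∧_; _xor_; not)
open import Data.Nat as ℕ using (ℕ; zero; suc; _<ᵇ_; _%_; _≡ᵇ_)
open import Data.Fin using (Fin; toℕ)
open import Data.List using (List; []; _∷_; _++_; [_]; length; filter; allFin; foldr; map; concatMap)
open import Data.List.Relation.Unary.Linked using (Linked)
open import Data.List.Relation.Unary.Unique.Propositional using (Unique)
open import Data.Product using (Σ; ∃; _×_; _,_)
open import Data.Rational as ℚ using (ℚ; 0ℚ; 1ℚ; ½)
open import Relation.Binary.PropositionalEquality using (_≡_)
open import Relation.Nullary using (¬_)

-- Vertices of the complete graph K_n are Fin n.  An edge is an unordered
-- pair {i,j}, i ≠ j, represented by the ordered pair (i , j) with i < j.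
-- Edge weights / edge sets are functions Fin n → Fin n → _ of which only the
-- entries with i < j are used.

Edges : (n : ℕ) → List (Fin n × Fin n)
Edges n = concatMap (λ i → map (λ j → (i , j)) (filter (λ j → Data.Bool._≟_ (toℕ i <ᵇ toℕ j) true) (allFin n))) (allFin n)
  where import Data.Bool

EdgeWeight : ℕ → Set
EdgeWeight n = Fin n → Fin n → ℚ

EdgeSet : ℕ → Set
EdgeSet n = Fin n → Fin n → Bool

VSet : ℕ → Set
VSet n = Fin n → Bool

sumℚ : List ℚ → ℚ
sumℚ = foldr ℚ._+_ 0ℚ

Σℚ : (l : ℕ) → (Fin l → ℚ) → ℚ
Σℚ l f = sumℚ (map f (allFin l))

xOf : ∀ {n} → EdgeWeight n → (Fin n → Fin n → Bool) → ℚ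
xOf {n} x P = sumℚ (map (λ { (i , j) → if P i j then x i j else 0ℚ }) (Edges n))

inδ : ∀ {n} → VSet n → Fin n → Fin n → Bool
inδ S i j = S i xor S j

xδ : ∀ {n} → EdgeWeight n → VSet n → ℚ
xδ x S = xOf x (inδ S)

singleton : ∀ {n} → Fin n → VSet n
singleton v u = toℕ u ≡ᵇ toℕ v

IsCut : ∀ {n} → VSet n → Set
IsCut S = (∃ λ v → S v ≡ true) × (∃ λ v → S v ≡ false)

count : ∀ {n} → VSet n → ℕ
count {n} S = length (filter (λ v → Data.Bool._≟_ (S v) true) (allFin n))
  where import Data.Bool

isOdd : ℕ → Bool
isOdd m = m % 2 ≡ᵇ 1

countST : ∀ {n} → VSet n → Fin n → Fin n → ℕ
countST S s t = (if S s then 1 else 0) ℕ.+ (if S t then 1 else 0)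

record FeasibleLP1 {n : ℕ} (s t : Fin n) (x : EdgeWeight n) : Set where
  field
    deg-s : xδ x (singleton s) ≡ 1ℚ
    deg-t : xδ x (singleton t) ≡ 1ℚ
    deg-v : ∀ v → ¬ v ≡ s → ¬ v ≡ t → xδ x (singleton v) ≡ ℚ._+_ 1ℚ 1ℚ
    st-cut : ∀ S → IsCut S → isOdd (countST S s t) ≡ true → 1ℚ ℚ.≤ xδ x S
    even-cut : ∀ S → IsCut S → isOdd (countST S s t) ≡ false → ℚ._+_ 1ℚ 1ℚ ℚ.≤ xδ x S
    lower : ∀ i j → toℕ i ℕ.< toℕ j → 0ℚ ℚ.≤ x i j
    upper : ∀ i j → toℕ i ℕ.< toℕ j → x i j ℚ.≤ 1ℚ

HalfIntegral : ∀ {n} → EdgeWeight n → Set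
HalfIntegral {n} x = ∀ (i j : Fin n) → toℕ i ℕ.< toℕ j → (x i j ≡ 0ℚ) Data.Sum.⊎ ((x i j ≡ ½) Data.Sum.⊎ (x i j ≡ 1ℚ))
  where import Data.Sum

adj : ∀ {n} → EdgeSet n → Fin n → Fin n → Bool
adj A u v = if toℕ u <ᵇ toℕ v then A u v else (if toℕ v <ᵇ toℕ u then A v u else false)

Adj : ∀ {n} → EdgeSet n → Fin n → Fin n → Set
Adj A u v = adj A u v ≡ true

data Reach {n} (A : EdgeSet n) : Fin n → Fin n → Set where
  here : ∀ {u} → Reach A u u
  step : ∀ {u v w} → Adj A u v → Reach A v w → Reach A u w

Connected : ∀ {n} → EdgeSet n → Set
Connected A = ∀ u v → Reach A u v

HasCycle : ∀ {n} → EdgeSet n → Set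
HasCycle {n} A = Σ (Fin n) λ v → Σ (List (Fin n)) λ ws →
  (3 ℕ.≤ length (v ∷ ws)) × Unique (v ∷ ws) × Linked (Adj A) (v ∷ ws ++ [ v ])

SpanningTree : ∀ {n} → EdgeSet n → Set
SpanningTree A = Connected A × ¬ HasCycle A

χ : ∀ {n} → EdgeSet n → EdgeWeight n
χ A i j = if A i j then 1ℚ else 0ℚ

deg : ∀ {n} → EdgeSet n → Fin n → ℕ
deg A v = count (adj A v)

isST : ∀ {n} → Fin n → Fin n → Fin n → Bool
isST s t v = (toℕ v ≡ᵇ toℕ s) Data.Bool.∨ (toℕ v ≡ᵇ toℕ t)
  where import Data.Bool

WrongDeg : ∀ {n} → Fin n → Fin n → EdgeSet n → VSet n
WrongDeg s t K v = if isST s t v then not (isOdd (deg K v)) else isOdd (deg K v)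

_∩_ : ∀ {n} → VSet n → VSet n → VSet n
(S ∩ T) v = S v ∧ T v

record ConvexTreeCombination {n : ℕ} (x : EdgeWeight n) (l : ℕ)
       (λs : Fin l → ℚ) (Js : Fin l → EdgeSet n) : Set where
  field
    trees : ∀ k → SpanningTree (Js k)
    pos : ∀ k → 0ℚ ℚ.< λs k
    sum1 : Σℚ l λs ≡ 1ℚ
    comb : ∀ i j → toℕ i ℕ.< toℕ j → x i j ≡ Σℚ l (λ k → ℚ._*_ (λs k) (χ (Js k) i j))

-- If |S ∩ {s,t}| is even, the bound is a constraint of (L.P.1). Otherwise every tree crosses
-- the cut S at least once, and the sampled tree J an even number of times: by the handshake
-- identity, |J ∩ δ(S)| ≡ Σ_{v ∈ S} deg_J v ≡ |S ∩ T| + |S ∩ {s,t}| (mod 2). So the convex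
-- combination gives x(δ(S)) > 1. On the other hand z = 2x is integral with z(δ(v)) ∈ {2, 4}
-- at every vertex, so the handshake identity makes z(δ(S)) even and x(δ(S)) an integer.

module Submission where

open import Algebra.Bundles using (Semiring; CommutativeRing)
import Algebra.Properties.Semiring.Mult as SemiringMult
import Algebra.Properties.Semiring.Sum as SemiringSum
open import Data.Bool as Bool using (Bool; true; false; if_then_else_; _∧_; _xor_; not; T)
import Data.Bool.Properties as Bool
open import Data.Empty using (⊥; ⊥-elim)
open import Data.Fin using (Fin; toℕ; zero; suc)
import Data.Fin.Properties as Fin
open import Data.List using (List; []; _∷_; map; filter; length; foldr; tabulate; allFin; concatMap)
import Data.List.Properties as List
open import Data.List.Relation.Unary.All as All using (All; []; _∷_)
import Data.List.Relation.Unary.All.Properties as All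
open import Data.Nat using (ℕ; zero; suc; _+_; _*_; _≤_; _<_; _<ᵇ_; _≡ᵇ_; z≤n; s≤s; parity)
open import Data.Nat.ListAction using (sum)
open import Data.Nat.ListAction.Properties using (sum-++)
import Data.Nat.Properties as ℕ
open import Data.Parity.Base as ℙ using (0ℙ; 1ℙ)
import Data.Parity.Properties as ℙ
open import Data.Product using (Σ; ∃; _×_; _,_; proj₁; proj₂)
open import Data.Rational as ℚ using (ℚ; 0ℚ; 1ℚ; ½)
import Data.Rational.Properties as ℚ
open import Data.Sum using (_⊎_; inj₁; inj₂)
open import Data.Unit using (tt)
open import Function using (_∘_; id)
open import Level using (0ℓ)
open import Relation.Binary.PropositionalEquality hiding ([_])
open import Relation.Nullary using (¬_; contradiction; yes; no)
open import Relation.Nullary.Decidable using (toWitness)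

open import Defs

[_] : Bool → ℕ
[ b ] = if b then 1 else 0

[]+[] : ∀ a b → [ a ] + [ b ] ≡ 2 * [ a ∧ b ] + [ a xor b ]
[]+[] true  true  = refl
[]+[] true  false = refl
[]+[] false true  = refl
[]+[] false false = refl

[]*[] : ∀ a b → [ a ] * [ b ] ≡ [ a ∧ b ]
[]*[] true  true  = refl
[]*[] true  false = refl
[]*[] false b     = refl

[xor]*-distrib : ∀ a b u → (a ≡ true → b ≡ true → u ≡ 0) → [ a xor b ] * u ≡ [ a ] * u + [ b ] * u
[xor]*-distrib true  true  u diag rewrite diag refl refl = refl
[xor]*-distrib true  false u _    = sym (ℕ.+-identityʳ _)
[xor]*-distrib false true  u _    = refl
[xor]*-distrib false false u _    = refl

<ᵇ-irrefl : ∀ m → (m <ᵇ m) ≡ false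
<ᵇ-irrefl zero    = refl
<ᵇ-irrefl (suc m) = <ᵇ-irrefl m

<ᵇ-asym : ∀ m n → (m <ᵇ n) ≡ true → (n <ᵇ m) ≡ false
<ᵇ-asym zero    (suc n) _ = refl
<ᵇ-asym (suc m) (suc n) p = <ᵇ-asym m n p

≡ᵇ-true⇒≡ : ∀ {m n} → (m ≡ᵇ n) ≡ true → m ≡ n
≡ᵇ-true⇒≡ {m} {n} p = ℕ.≡ᵇ⇒≡ m n (subst T (sym p) tt)

-- Finite sums

module ℕΣ = SemiringSum ℕ.+-*-semiring

∑ℕ : ∀ {m} → (Fin m → ℕ) → ℕ
∑ℕ = ℕΣ.sum

∑∑ : ∀ {m n} → (Fin m → Fin n → ℕ) → ℕ
∑∑ f = ∑ℕ λ i → ∑ℕ (f i)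

∑∑-cong : ∀ {m n} {f g : Fin m → Fin n → ℕ} → (∀ i j → f i j ≡ g i j) → ∑∑ f ≡ ∑∑ g
∑∑-cong f≗g = ℕΣ.sum-cong-≗ λ i → ℕΣ.sum-cong-≗ (f≗g i)

∑∑-distrib-+ : ∀ {m n} (f g : Fin m → Fin n → ℕ) → ∑∑ (λ i j → f i j + g i j) ≡ ∑∑ f + ∑∑ g
∑∑-distrib-+ f g = trans (ℕΣ.sum-cong-≗ λ i → ℕΣ.∑-distrib-+ (f i) (g i))
                         (ℕΣ.∑-distrib-+ (λ i → ∑ℕ (f i)) (λ i → ∑ℕ (g i)))

∑∑-factorˡ : ∀ {m n} (a : Fin m → ℕ) (g : Fin m → Fin n → ℕ) →
             ∑∑ (λ i j → a i * g i j) ≡ ∑ℕ λ i → a i * ∑ℕ (g i)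
∑∑-factorˡ a g = ℕΣ.sum-cong-≗ λ i → sym (ℕΣ.*-distribˡ-sum (a i) (g i))

term≤∑ : ∀ {m} (f : Fin m → ℕ) i → f i ≤ ∑ℕ f
term≤∑ f zero    = ℕ.m≤m+n _ _
term≤∑ f (suc i) = ℕ.≤-trans (term≤∑ (f ∘ suc) i) (ℕ.m≤n+m _ _)

term≤∑∑ : ∀ {m n} (f : Fin m → Fin n → ℕ) i j → f i j ≤ ∑∑ f
term≤∑∑ f i j = ℕ.≤-trans (term≤∑ (f i) j) (term≤∑ (λ i → ∑ℕ (f i)) i)

∑-singleton : ∀ {n} (v : Fin n) (f : Fin n → ℕ) → ∑ℕ (λ u → [ singleton v u ] * f u) ≡ f v
∑-singleton {suc n} zero f = begin
  f zero + 0 + ∑ℕ {n} (λ _ → 0)  ≡⟨ cong (f zero + 0 +_) (ℕΣ.sum-replicate-zero n) ⟩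
  f zero + 0 + 0                 ≡⟨ trans (ℕ.+-identityʳ _) (ℕ.+-identityʳ _) ⟩
  f zero                         ∎
  where open ≡-Reasoning
∑-singleton (suc v) f = ∑-singleton v (f ∘ suc)

module _ {c ℓ} (R : Semiring c ℓ) where
  private module R = Semiring R
  open R using (Carrier; _≈_)
  open SemiringSum R renaming (sum to ∑)

  foldr-map-tabulate : ∀ {a} {A : Set a} {m} (f : A → Carrier) (g : Fin m → A) →
                       foldr R._+_ R.0# (map f (tabulate g)) ≈ ∑ (f ∘ g)
  foldr-map-tabulate {m = zero}  f g = R.refl
  foldr-map-tabulate {m = suc m} f g = R.+-congˡ (foldr-map-tabulate f (g ∘ suc))

  foldr-map-allFin : ∀ {m} (f : Fin m → Carrier) → foldr R._+_ R.0# (map f (allFin m)) ≈ ∑ f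
  foldr-map-allFin f = foldr-map-tabulate f id

module _ {a} {A : Set a} where
  sum-concatMap : (g : A → List ℕ) (xs : List A) → sum (concatMap g xs) ≡ sum (map (sum ∘ g) xs)
  sum-concatMap g []       = refl
  sum-concatMap g (x ∷ xs) = trans (sum-++ (g x) _) (cong (sum (g x) +_) (sum-concatMap g xs))

  sum-map-filter : (f : A → ℕ) (b : A → Bool) (xs : List A) →
                   sum (map f (filter (λ a → b a Bool.≟ true) xs)) ≡ sum (map (λ a → if b a then f a else 0) xs)
  sum-map-filter f b []       = refl
  sum-map-filter f b (x ∷ xs) with b x
  ... | true  = cong (f x +_) (sum-map-filter f b xs)
  ... | false = sum-map-filter f b xs

  length-filter : (b : A → Bool) (xs : List A) →
                  length (filter (λ a → b a Bool.≟ true) xs) ≡ sum (map (λ a → [ b a ]) xs)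
  length-filter b []       = refl
  length-filter b (x ∷ xs) with b x
  ... | true  = cong suc (length-filter b xs)
  ... | false = length-filter b xs

count≡∑ : ∀ {n} (S : VSet n) → count S ≡ ∑ℕ (λ v → [ S v ])
count≡∑ {n} S = trans (length-filter S (allFin n)) (foldr-map-allFin ℕ.+-*-semiring (λ v → [ S v ]))

count-∩ : ∀ {n} (S T : VSet n) → count (S ∩ T) ≡ ∑ℕ λ v → [ S v ] * [ T v ]
count-∩ S T = trans (count≡∑ (S ∩ T)) (ℕΣ.sum-cong-≗ λ v → sym ([]*[] (S v) (T v)))

sum-map-Edges : ∀ {n} (f : Fin n × Fin n → ℕ) →
  sum (map f (Edges n)) ≡ ∑∑ λ i j → if toℕ i <ᵇ toℕ j then f (i , j) else 0
sum-map-Edges {n} f = begin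
  sum (map f (concatMap row (allFin n)))
    ≡⟨ cong sum (List.map-concatMap f row (allFin n)) ⟩
  sum (concatMap (map f ∘ row) (allFin n))
    ≡⟨ sum-concatMap (map f ∘ row) (allFin n) ⟩
  sum (map (sum ∘ map f ∘ row) (allFin n))
    ≡⟨ foldr-map-allFin ℕ.+-*-semiring (λ i → sum (map f (row i))) ⟩
  ∑ℕ (λ i → sum (map f (row i)))
    ≡⟨ ℕΣ.sum-cong-≗ rowSum ⟩
  ∑∑ (λ i j → if toℕ i <ᵇ toℕ j then f (i , j) else 0) ∎
  where
  open ≡-Reasoning
  row : Fin n → List (Fin n × Fin n)
  row i = map (i ,_) (filter (λ j → (toℕ i <ᵇ toℕ j) Bool.≟ true) (allFin n))
  rowSum : ∀ i → sum (map f (row i)) ≡ ∑ℕ λ j → if toℕ i <ᵇ toℕ j then f (i , j) else 0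
  rowSum i = begin
    sum (map f (row i))
      ≡⟨ cong sum (sym (List.map-∘ (filter _ (allFin n)))) ⟩
    sum (map (f ∘ (i ,_)) (filter _ (allFin n)))
      ≡⟨ sum-map-filter (f ∘ (i ,_)) (λ j → toℕ i <ᵇ toℕ j) (allFin n) ⟩
    sum (map (λ j → if toℕ i <ᵇ toℕ j then f (i , j) else 0) (allFin n))
      ≡⟨ foldr-map-allFin ℕ.+-*-semiring (λ j → if toℕ i <ᵇ toℕ j then f (i , j) else 0) ⟩
    ∑ℕ (λ j → if toℕ i <ᵇ toℕ j then f (i , j) else 0) ∎

-- Integer edge weights and the handshake identity

ℕWeight : ℕ → Set
ℕWeight n = Fin n → Fin n → ℕ

upper : ∀ {n} → ℕWeight n → Fin n → Fin n → ℕ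
upper w i j = if toℕ i <ᵇ toℕ j then w i j else 0

wOf : ∀ {n} → ℕWeight n → (Fin n → Fin n → Bool) → ℕ
wOf w P = ∑∑ λ i j → [ P i j ] * upper w i j

wδ : ∀ {n} → ℕWeight n → VSet n → ℕ
wδ w S = wOf w (inδ S)

χℕ : ∀ {n} → EdgeSet n → ℕWeight n
χℕ A i j = [ A i j ]

sum-map-Edges-wOf : ∀ {n} (w : ℕWeight n) (P : Fin n → Fin n → Bool) →
  sum (map (λ { (i , j) → if P i j then w i j else 0 }) (Edges n)) ≡ wOf w P
sum-map-Edges-wOf w P = trans (sum-map-Edges λ { (i , j) → if P i j then w i j else 0 })
                               (∑∑-cong λ i j → term (toℕ i <ᵇ toℕ j) (P i j))
  where
  term : ∀ {u} b p → (if b then (if p then u else 0) else 0) ≡ [ p ] * (if b then u else 0)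
  term {u} true  true  = sym (ℕ.+-identityʳ u)
  term     true  false = refl
  term     false p     = sym (ℕ.*-zeroʳ [ p ])

upper-diag : ∀ {n} (w : ℕWeight n) {i j} → toℕ i ≡ toℕ j → upper w i j ≡ 0
upper-diag w {i} {j} i≡j =
  cong (λ b → if b then w i j else 0) (trans (cong (_<ᵇ toℕ j) i≡j) (<ᵇ-irrefl (toℕ j)))

star : ∀ {n} (w : ℕWeight n) (v : Fin n) → wδ w (singleton v) ≡ ∑ℕ λ u → upper w v u + upper w u v
star {n} w v = begin
  ∑∑ (λ i j → [ sv i xor sv j ] * U i j)
    ≡⟨ ∑∑-cong (λ i j → [xor]*-distrib (sv i) (sv j) (U i j) (diagonal i j)) ⟩
  ∑∑ (λ i j → [ sv i ] * U i j + [ sv j ] * U i j)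
    ≡⟨ ∑∑-distrib-+ (λ i j → [ sv i ] * U i j) (λ i j → [ sv j ] * U i j) ⟩
  ∑∑ (λ i j → [ sv i ] * U i j) + ∑∑ (λ i j → [ sv j ] * U i j)
    ≡⟨ cong (∑∑ (λ i j → [ sv i ] * U i j) +_) (ℕΣ.∑-comm (λ i j → [ sv j ] * U i j)) ⟩
  ∑∑ (λ i j → [ sv i ] * U i j) + ∑∑ (λ j i → [ sv j ] * U i j)
    ≡⟨ cong₂ _+_ (trans (∑∑-factorˡ (λ i → [ sv i ]) U) (∑-singleton v (λ i → ∑ℕ (U i))))
                 (trans (∑∑-factorˡ (λ j → [ sv j ]) (λ j i → U i j)) (∑-singleton v (λ j → ∑ℕ λ i → U i j))) ⟩
  ∑ℕ (U v) + ∑ℕ (λ u → U u v)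
    ≡⟨ sym (ℕΣ.∑-distrib-+ (U v) (λ u → U u v)) ⟩
  ∑ℕ (λ u → U v u + U u v) ∎
  where
  open ≡-Reasoning
  U : ℕWeight n
  U = upper w
  sv : VSet n
  sv = singleton v
  diagonal : ∀ i j → sv i ≡ true → sv j ≡ true → U i j ≡ 0
  diagonal i j iv jv = upper-diag w (trans (≡ᵇ-true⇒≡ iv) (sym (≡ᵇ-true⇒≡ jv)))

handshake : ∀ {n} (w : ℕWeight n) (S : VSet n) →
  ∑ℕ (λ v → [ S v ] * wδ w (singleton v)) ≡ 2 * wOf w (λ i j → S i ∧ S j) + wδ w S
handshake {n} w S = begin
  ∑ℕ (λ v → [ S v ] * wδ w (singleton v))
    ≡⟨ ℕΣ.sum-cong-≗ (λ v → cong ([ S v ] *_) (star w v)) ⟩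
  ∑ℕ (λ v → [ S v ] * ∑ℕ λ u → U v u + U u v)
    ≡⟨ sym (∑∑-factorˡ (λ v → [ S v ]) (λ v u → U v u + U u v)) ⟩
  ∑∑ (λ v u → [ S v ] * (U v u + U u v))
    ≡⟨ ∑∑-cong (λ v u → ℕ.*-distribˡ-+ [ S v ] (U v u) (U u v)) ⟩
  ∑∑ (λ v u → [ S v ] * U v u + [ S v ] * U u v)
    ≡⟨ ∑∑-distrib-+ (λ v u → [ S v ] * U v u) (λ v u → [ S v ] * U u v) ⟩
  ∑∑ (λ i j → [ S i ] * U i j) + ∑∑ (λ v u → [ S v ] * U u v)
    ≡⟨ cong (∑∑ (λ i j → [ S i ] * U i j) +_) (ℕΣ.∑-comm (λ v u → [ S v ] * U u v)) ⟩
  ∑∑ (λ i j → [ S i ] * U i j) + ∑∑ (λ i j → [ S j ] * U i j)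
    ≡⟨ sym (∑∑-distrib-+ (λ i j → [ S i ] * U i j) (λ i j → [ S j ] * U i j)) ⟩
  ∑∑ (λ i j → [ S i ] * U i j + [ S j ] * U i j)
    ≡⟨ ∑∑-cong (λ i j → pair (S i) (S j) (U i j)) ⟩
  ∑∑ (λ i j → 2 * ([ S i ∧ S j ] * U i j) + [ inδ S i j ] * U i j)
    ≡⟨ ∑∑-distrib-+ (λ i j → 2 * ([ S i ∧ S j ] * U i j)) (λ i j → [ inδ S i j ] * U i j) ⟩
  ∑∑ (λ i j → 2 * ([ S i ∧ S j ] * U i j)) + wδ w S
    ≡⟨ cong (_+ wδ w S) (trans (∑∑-factorˡ (λ _ → 2) (λ i j → [ S i ∧ S j ] * U i j))
                                (sym (ℕΣ.*-distribˡ-sum 2 (λ i → ∑ℕ λ j → [ S i ∧ S j ] * U i j)))) ⟩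
  2 * wOf w (λ i j → S i ∧ S j) + wδ w S ∎
  where
  open ≡-Reasoning
  U : ℕWeight n
  U = upper w
  pair : ∀ a b u → [ a ] * u + [ b ] * u ≡ 2 * ([ a ∧ b ] * u) + [ a xor b ] * u
  pair a b u = begin
    [ a ] * u + [ b ] * u                    ≡⟨ sym (ℕ.*-distribʳ-+ u [ a ] [ b ]) ⟩
    ([ a ] + [ b ]) * u                      ≡⟨ cong (_* u) ([]+[] a b) ⟩
    (2 * [ a ∧ b ] + [ a xor b ]) * u        ≡⟨ ℕ.*-distribʳ-+ u (2 * [ a ∧ b ]) [ a xor b ] ⟩
    2 * [ a ∧ b ] * u + [ a xor b ] * u      ≡⟨ cong (_+ [ a xor b ] * u) (ℕ.*-assoc 2 [ a ∧ b ] u) ⟩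
    2 * ([ a ∧ b ] * u) + [ a xor b ] * u    ∎

adj≡upper : ∀ {n} (A : EdgeSet n) v u → [ adj A v u ] ≡ upper (χℕ A) v u + upper (χℕ A) u v
adj≡upper A v u with toℕ v <ᵇ toℕ u in v<u
... | true rewrite <ᵇ-asym (toℕ v) (toℕ u) v<u = sym (ℕ.+-identityʳ _)
... | false with toℕ u <ᵇ toℕ v
...   | true  = refl
...   | false = refl

deg≡wδ : ∀ {n} (A : EdgeSet n) v → deg A v ≡ wδ (χℕ A) (singleton v)
deg≡wδ A v = trans (count≡∑ (adj A v)) (trans (ℕΣ.sum-cong-≗ (adj≡upper A v)) (sym (star (χℕ A) v)))

-- Parity of cuts

parity-∑-even : ∀ {m} (f : Fin m → ℕ) → (∀ i → parity (f i) ≡ 0ℙ) → parity (∑ℕ f) ≡ 0ℙ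
parity-∑-even {zero}  f even = refl
parity-∑-even {suc m} f even =
  trans (ℙ.+-homo-+ (f zero) (∑ℕ (f ∘ suc))) (cong₂ ℙ._+_ (even zero) (parity-∑-even (f ∘ suc) (even ∘ suc)))

parity-[]*-even : ∀ b {m} → parity m ≡ 0ℙ → parity ([ b ] * m) ≡ 0ℙ
parity-[]*-even b {m} even = trans (ℙ.*-homo-* [ b ] m) (trans (cong (parity [ b ] ℙ.*_) even) (ℙ.*-zeroʳ _))

parity≡isOdd : ∀ m → parity m ≡ (if isOdd m then 1ℙ else 0ℙ)
parity≡isOdd 0             = refl
parity≡isOdd 1             = refl
parity≡isOdd (suc (suc m)) = parity≡isOdd m

isOdd⇒parity≡1ℙ : ∀ {m} → isOdd m ≡ true → parity m ≡ 1ℙ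
isOdd⇒parity≡1ℙ {m} odd = trans (parity≡isOdd m) (cong (λ b → if b then 1ℙ else 0ℙ) odd)

p+q+r≡0ℙ⇒p≡q+r : ∀ p q r → p ℙ.+ q ℙ.+ r ≡ 0ℙ → p ≡ q ℙ.+ r
p+q+r≡0ℙ⇒p≡q+r 0ℙ q  r  eq = sym eq
p+q+r≡0ℙ⇒p≡q+r 1ℙ 0ℙ 0ℙ ()
p+q+r≡0ℙ⇒p≡q+r 1ℙ 0ℙ 1ℙ _  = refl
p+q+r≡0ℙ⇒p≡q+r 1ℙ 1ℙ 0ℙ _  = refl
p+q+r≡0ℙ⇒p≡q+r 1ℙ 1ℙ 1ℙ ()

even-≥1⇒≥2 : ∀ {m} → 1 ≤ m → parity m ≡ 0ℙ → 2 ≤ m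
even-≥1⇒≥2 {suc (suc m)} _ _ = s≤s (s≤s z≤n)

even⇒≡2* : ∀ m → parity m ≡ 0ℙ → ∃ λ k → m ≡ 2 * k
even⇒≡2* 0             _    = 0 , refl
even⇒≡2* (suc (suc m)) even with even⇒≡2* m even
... | k , refl = suc k , sym (ℕ.*-suc 2 k)

parity-handshake : ∀ {n} (w : ℕWeight n) (S : VSet n) →
  parity (∑ℕ λ v → [ S v ] * wδ w (singleton v)) ≡ parity (wδ w S)
parity-handshake {n} w S = begin
  parity (∑ℕ λ v → [ S v ] * wδ w (singleton v)) ≡⟨ cong parity (handshake w S) ⟩
  parity (2 * E + wδ w S)                          ≡⟨ ℙ.+-homo-+ (2 * E) (wδ w S) ⟩
  parity (2 * E) ℙ.+ parity (wδ w S)               ≡⟨ cong (ℙ._+ parity (wδ w S)) (ℙ.*-homo-* 2 E) ⟩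
  parity (wδ w S)                                  ∎
  where
  open ≡-Reasoning
  E : ℕ
  E = wOf w (λ i j → S i ∧ S j)

even-stars⇒even-cuts : ∀ {n} (w : ℕWeight n) → (∀ v → parity (wδ w (singleton v)) ≡ 0ℙ) →
                       ∀ S → parity (wδ w S) ≡ 0ℙ
even-stars⇒even-cuts w even-star S =
  trans (sym (parity-handshake w S)) (parity-∑-even _ λ v → parity-[]*-even (S v) (even-star v))

countST≡∑ : ∀ {n} (S : VSet n) {s t : Fin n} → ¬ s ≡ t → countST S s t ≡ ∑ℕ λ v → [ S v ] * [ isST s t v ]
countST≡∑ S {s} {t} s≢t = sym (begin
  ∑ℕ (λ v → [ S v ] * [ singleton s v Bool.∨ singleton t v ])
    ≡⟨ ℕΣ.sum-cong-≗ (λ v → split (S v) (singleton s v) (singleton t v) (exclusive v)) ⟩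
  ∑ℕ (λ v → [ singleton s v ] * [ S v ] + [ singleton t v ] * [ S v ])
    ≡⟨ ℕΣ.∑-distrib-+ (λ v → [ singleton s v ] * [ S v ]) (λ v → [ singleton t v ] * [ S v ]) ⟩
  ∑ℕ (λ v → [ singleton s v ] * [ S v ]) + ∑ℕ (λ v → [ singleton t v ] * [ S v ])
    ≡⟨ cong₂ _+_ (∑-singleton s (λ v → [ S v ])) (∑-singleton t (λ v → [ S v ])) ⟩
  countST S s t ∎)
  where
  open ≡-Reasoning
  exclusive : ∀ v → singleton s v ≡ true → singleton t v ≡ true → ⊥
  exclusive v vs vt =
    s≢t (Fin.toℕ-injective (trans (sym (≡ᵇ-true⇒≡ {toℕ v} vs)) (≡ᵇ-true⇒≡ {toℕ v} vt)))
  split : ∀ c a b → (a ≡ true → b ≡ true → ⊥) → [ c ] * [ a Bool.∨ b ] ≡ [ a ] * [ c ] + [ b ] * [ c ]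
  split c     true  true  excl = ⊥-elim (excl refl refl)
  split true  true  false _    = refl
  split true  false true  _    = refl
  split true  false false _    = refl
  split false true  false _    = refl
  split false false true  _    = refl
  split false false false _    = refl

wrongDeg-balanced : ∀ {n} (s t : Fin n) (A : EdgeSet n) v →
  parity (deg A v + [ WrongDeg s t A v ] + [ isST s t v ]) ≡ 0ℙ
wrongDeg-balanced s t A v = balanced (deg A v) (isST s t v)
  where
  balanced : ∀ d st → parity (d + [ if st then not (isOdd d) else isOdd d ] + [ st ]) ≡ 0ℙ
  balanced d st
    rewrite ℙ.+-homo-+ (d + [ if st then not (isOdd d) else isOdd d ]) [ st ]
          | ℙ.+-homo-+ d [ if st then not (isOdd d) else isOdd d ]
          | parity≡isOdd d
    with isOdd d | st
  ... | true  | true  = refl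
  ... | true  | false = refl
  ... | false | true  = refl
  ... | false | false = refl

degree-parity : ∀ {n} {s t : Fin n} → ¬ s ≡ t → (A : EdgeSet n) (S : VSet n) →
  parity (∑ℕ λ v → [ S v ] * deg A v) ≡ parity (count (S ∩ WrongDeg s t A)) ℙ.+ parity (countST S s t)
degree-parity {n} {s} {t} s≢t A S = p+q+r≡0ℙ⇒p≡q+r _ _ _ (begin
  parity D ℙ.+ parity (count (S ∩ W)) ℙ.+ parity (countST S s t)
    ≡⟨ cong₂ (λ p q → parity D ℙ.+ p ℙ.+ q) (cong parity (count-∩ S W)) (cong parity (countST≡∑ S s≢t)) ⟩
  parity D ℙ.+ parity DW ℙ.+ parity DST
    ≡⟨ sym (trans (ℙ.+-homo-+ (D + DW) DST) (cong (ℙ._+ parity DST) (ℙ.+-homo-+ D DW))) ⟩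
  parity (D + DW + DST)
    ≡⟨ cong parity (sym split) ⟩
  parity (∑ℕ λ v → [ S v ] * (deg A v + [ W v ] + [ st v ]))
    ≡⟨ parity-∑-even _ (λ v → parity-[]*-even (S v) (wrongDeg-balanced s t A v)) ⟩
  0ℙ ∎)
  where
  open ≡-Reasoning
  W st : VSet n
  W = WrongDeg s t A
  st = isST s t
  D DW DST : ℕ
  D = ∑ℕ λ v → [ S v ] * deg A v
  DW = ∑ℕ λ v → [ S v ] * [ W v ]
  DST = ∑ℕ λ v → [ S v ] * [ st v ]
  split : (∑ℕ λ v → [ S v ] * (deg A v + [ W v ] + [ st v ])) ≡ D + DW + DST
  split = begin
    ∑ℕ (λ v → [ S v ] * (deg A v + [ W v ] + [ st v ]))
      ≡⟨ ℕΣ.sum-cong-≗ (λ v → trans (ℕ.*-distribˡ-+ [ S v ] (deg A v + [ W v ]) [ st v ])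
                                    (cong (_+ [ S v ] * [ st v ]) (ℕ.*-distribˡ-+ [ S v ] (deg A v) [ W v ]))) ⟩
    ∑ℕ (λ v → [ S v ] * deg A v + [ S v ] * [ W v ] + [ S v ] * [ st v ])
      ≡⟨ ℕΣ.∑-distrib-+ (λ v → [ S v ] * deg A v + [ S v ] * [ W v ]) (λ v → [ S v ] * [ st v ]) ⟩
    ∑ℕ (λ v → [ S v ] * deg A v + [ S v ] * [ W v ]) + DST
      ≡⟨ cong (_+ DST) (ℕΣ.∑-distrib-+ (λ v → [ S v ] * deg A v) (λ v → [ S v ] * [ W v ])) ⟩
    D + DW + DST ∎

parity-crossings : ∀ {n} {s t : Fin n} → ¬ s ≡ t → (A : EdgeSet n) (S : VSet n) →
  parity (wδ (χℕ A) S) ≡ parity (count (S ∩ WrongDeg s t A)) ℙ.+ parity (countST S s t)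
parity-crossings s≢t A S = begin
  parity (wδ (χℕ A) S)
    ≡⟨ sym (parity-handshake (χℕ A) S) ⟩
  parity (∑ℕ λ v → [ S v ] * wδ (χℕ A) (singleton v))
    ≡⟨ cong parity (ℕΣ.sum-cong-≗ λ v → cong ([ S v ] *_) (sym (deg≡wδ A v))) ⟩
  parity (∑ℕ λ v → [ S v ] * deg A v)
    ≡⟨ degree-parity s≢t A S ⟩
  _ ∎
  where open ≡-Reasoning

walk-crosses : ∀ {n} {A : EdgeSet n} (S : VSet n) {a b} → Reach A a b → S a ≡ true → S b ≡ false →
  Σ (Fin n) λ u → Σ (Fin n) λ w → Adj A u w × inδ S u w ≡ true
walk-crosses S here Sa Sb = contradiction (trans (sym Sa) Sb) λ ()
walk-crosses S {a} (step {v = v} av walk) Sa Sb with S v in Sv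
... | true  = walk-crosses S walk Sv Sb
... | false = a , v , av , cong₂ _xor_ Sa Sv

edge-crossing≥1 : ∀ {n} (A : EdgeSet n) (S : VSet n) i j →
  (toℕ i <ᵇ toℕ j) ≡ true → A i j ≡ true → inδ S i j ≡ true → 1 ≤ wδ (χℕ A) S
edge-crossing≥1 A S i j i<j Aij δij =
  ℕ.≤-trans (ℕ.≤-reflexive (sym term≡1)) (term≤∑∑ (λ i j → [ inδ S i j ] * upper (χℕ A) i j) i j)
  where
  term≡1 : [ inδ S i j ] * upper (χℕ A) i j ≡ 1
  term≡1 = cong₂ (λ a b → [ a ] * b) δij (trans (cong (λ c → if c then [ A i j ] else 0) i<j) (cong [_] Aij))

Adj-crossing≥1 : ∀ {n} (A : EdgeSet n) (S : VSet n) {u w} → Adj A u w → inδ S u w ≡ true → 1 ≤ wδ (χℕ A) S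
Adj-crossing≥1 A S {u} {w} uw δuw with toℕ u <ᵇ toℕ w in u<w
... | true  = edge-crossing≥1 A S u w u<w uw δuw
... | false with toℕ w <ᵇ toℕ u in w<u
...   | true  = edge-crossing≥1 A S w u w<u uw (trans (Bool.xor-comm (S w) (S u)) δuw)
Adj-crossing≥1 A S () δuw | false | false

connected-crossing≥1 : ∀ {n} {A : EdgeSet n} {S : VSet n} → Connected A → IsCut S → 1 ≤ wδ (χℕ A) S
connected-crossing≥1 {A = A} {S} conn ((a , Sa) , (b , Sb)) with walk-crosses S (conn a b) Sa Sb
... | u , w , uw , δuw = Adj-crossing≥1 A S uw δuw

connected-crossings≥2 : ∀ {n} {s t : Fin n} {A : EdgeSet n} {S : VSet n} → ¬ s ≡ t → Connected A → IsCut S →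
  isOdd (count (S ∩ WrongDeg s t A)) ≡ true → isOdd (countST S s t) ≡ true → 2 ≤ wδ (χℕ A) S
connected-crossings≥2 {s = s} {t} {A} {S} s≢t conn cut odd-T odd-st =
  even-≥1⇒≥2 (connected-crossing≥1 conn cut)
    (trans (parity-crossings s≢t A S) (cong₂ ℙ._+_ (isOdd⇒parity≡1ℙ {count (S ∩ WrongDeg s t A)} odd-T)
                                                   (isOdd⇒parity≡1ℙ {countST S s t} odd-st)))

-- Rational edge weights

ℚ-semiring : Semiring 0ℓ 0ℓ
ℚ-semiring = CommutativeRing.semiring ℚ.+-*-commutativeRing

module ℚΣ = SemiringSum ℚ-semiring
module ℚ× = SemiringMult ℚ-semiring

∑ℚ : ∀ {m} → (Fin m → ℚ) → ℚ
∑ℚ = ℚΣ.sum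

fromℕ : ℕ → ℚ
fromℕ n = n ℚ×.× 1ℚ

fromℕ-+ : ∀ m n → fromℕ (m + n) ≡ fromℕ m ℚ.+ fromℕ n
fromℕ-+ = ℚ×.×-homo-+ 1ℚ

fromℕ-* : ∀ m n → fromℕ (m * n) ≡ fromℕ m ℚ.* fromℕ n
fromℕ-* = ℚ×.×1-homo-*

fromℕ-nonNeg : ∀ n → 0ℚ ℚ.≤ fromℕ n
fromℕ-nonNeg zero    = ℚ.≤-refl
fromℕ-nonNeg (suc n) = ℚ.+-mono-≤ (toWitness {a? = 0ℚ ℚ.≤? 1ℚ} tt) (fromℕ-nonNeg n)

fromℕ-mono-≤ : ∀ {m n} → m ≤ n → fromℕ m ℚ.≤ fromℕ n
fromℕ-mono-≤ {m} m≤n with ℕ.m≤n⇒∃[o]m+o≡n m≤n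
... | o , refl = begin
  fromℕ m              ≡⟨ sym (ℚ.+-identityʳ (fromℕ m)) ⟩
  fromℕ m ℚ.+ 0ℚ       ≤⟨ ℚ.+-monoʳ-≤ (fromℕ m) (fromℕ-nonNeg o) ⟩
  fromℕ m ℚ.+ fromℕ o  ≡⟨ sym (fromℕ-+ m o) ⟩
  fromℕ (m + o)        ∎
  where open ℚ.≤-Reasoning

fromℕ-mono-< : ∀ {m n} → m < n → fromℕ m ℚ.< fromℕ n
fromℕ-mono-< {m} m<n = ℚ.<-≤-trans m<1+m (fromℕ-mono-≤ m<n)
  where
  m<1+m : fromℕ m ℚ.< 1ℚ ℚ.+ fromℕ m
  m<1+m = subst (ℚ._< 1ℚ ℚ.+ fromℕ m) (ℚ.+-identityˡ (fromℕ m))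
                (ℚ.+-monoˡ-< (fromℕ m) (toWitness {a? = 0ℚ ℚ.<? 1ℚ} tt))

fromℕ-cancel-< : ∀ {m n} → fromℕ m ℚ.< fromℕ n → m < n
fromℕ-cancel-< lt = ℕ.≰⇒> λ n≤m → ℚ.<-irrefl refl (ℚ.<-≤-trans lt (fromℕ-mono-≤ n≤m))

fromℕ-injective : ∀ {m n} → fromℕ m ≡ fromℕ n → m ≡ n
fromℕ-injective eq = ℕ.≤-antisym (ℕ.≮⇒≥ λ n<m → ℚ.<-irrefl (sym eq) (fromℕ-mono-< n<m))
                                 (ℕ.≮⇒≥ λ m<n → ℚ.<-irrefl eq (fromℕ-mono-< m<n))

½*fromℕ-2* : ∀ k → ½ ℚ.* fromℕ (2 * k) ≡ fromℕ k
½*fromℕ-2* k = begin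
  ½ ℚ.* fromℕ (2 * k)          ≡⟨ cong (½ ℚ.*_) (fromℕ-* 2 k) ⟩
  ½ ℚ.* (fromℕ 2 ℚ.* fromℕ k)  ≡⟨ sym (ℚ.*-assoc ½ (fromℕ 2) (fromℕ k)) ⟩
  1ℚ ℚ.* fromℕ k               ≡⟨ ℚ.*-identityˡ (fromℕ k) ⟩
  fromℕ k                      ∎
  where open ≡-Reasoning

½*fromℕ≡fromℕ⇒≡2* : ∀ {m k} → ½ ℚ.* fromℕ m ≡ fromℕ k → m ≡ 2 * k
½*fromℕ≡fromℕ⇒≡2* {m} {k} eq = fromℕ-injective (begin
  fromℕ m                        ≡⟨ sym (ℚ.*-identityˡ (fromℕ m)) ⟩
  fromℕ 2 ℚ.* ½ ℚ.* fromℕ m      ≡⟨ ℚ.*-assoc (fromℕ 2) ½ (fromℕ m) ⟩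
  fromℕ 2 ℚ.* (½ ℚ.* fromℕ m)    ≡⟨ cong (fromℕ 2 ℚ.*_) eq ⟩
  fromℕ 2 ℚ.* fromℕ k            ≡⟨ sym (fromℕ-* 2 k) ⟩
  fromℕ (2 * k)                  ∎)
  where open ≡-Reasoning

module _ {a} {A : Set a} where
  sumℚ-map-cong : ∀ {f g : A → ℚ} {xs} → All (λ e → f e ≡ g e) xs → sumℚ (map f xs) ≡ sumℚ (map g xs)
  sumℚ-map-cong []       = refl
  sumℚ-map-cong (p ∷ ps) = cong₂ ℚ._+_ p (sumℚ-map-cong ps)

  sumℚ-map-*ˡ : ∀ c (f : A → ℚ) xs → sumℚ (map (λ e → c ℚ.* f e) xs) ≡ c ℚ.* sumℚ (map f xs)
  sumℚ-map-*ˡ c f []       = sym (ℚ.*-zeroʳ c)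
  sumℚ-map-*ˡ c f (x ∷ xs) =
    trans (cong (c ℚ.* f x ℚ.+_) (sumℚ-map-*ˡ c f xs)) (sym (ℚ.*-distribˡ-+ c (f x) (sumℚ (map f xs))))

  sumℚ-map-∑ : ∀ {l} (f : Fin l → A → ℚ) xs →
               sumℚ (map (λ e → ∑ℚ λ k → f k e) xs) ≡ ∑ℚ λ k → sumℚ (map (f k) xs)
  sumℚ-map-∑ {l} f []       = sym (ℚΣ.sum-replicate-zero l)
  sumℚ-map-∑     f (x ∷ xs) = trans (cong (∑ℚ (λ k → f k x) ℚ.+_) (sumℚ-map-∑ f xs))
                                    (sym (ℚΣ.∑-distrib-+ (λ k → f k x) (λ k → sumℚ (map (f k) xs))))

  fromℕ-sum-map : ∀ (f : A → ℕ) xs → fromℕ (sum (map f xs)) ≡ sumℚ (map (fromℕ ∘ f) xs)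
  fromℕ-sum-map f []       = refl
  fromℕ-sum-map f (x ∷ xs) =
    trans (fromℕ-+ (f x) (sum (map f xs))) (cong (fromℕ (f x) ℚ.+_) (fromℕ-sum-map f xs))

Edges-ordered : ∀ n → All (λ e → toℕ (proj₁ e) < toℕ (proj₂ e)) (Edges n)
Edges-ordered n = All.concat⁺ (All.map⁺ (All.universal row-ordered (allFin n)))
  where
  row-ordered : ∀ i → All (λ e → toℕ (proj₁ e) < toℕ (proj₂ e))
                          (map (i ,_) (filter (λ j → (toℕ i <ᵇ toℕ j) Bool.≟ true) (allFin n)))
  row-ordered i = All.map⁺ (All.map (λ i<j → ℕ.<ᵇ⇒< (toℕ i) _ (subst T (sym i<j) tt))
                                    (All.all-filter (λ j → (toℕ i <ᵇ toℕ j) Bool.≟ true) (allFin n)))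

module _ {n : ℕ} (P : Fin n → Fin n → Bool) where
  xOf-cong : ∀ {x y : EdgeWeight n} → (∀ i j → toℕ i < toℕ j → x i j ≡ y i j) → xOf x P ≡ xOf y P
  xOf-cong x≐y = sumℚ-map-cong (All.map (λ { {i , j} i<j → cong (λ q → if P i j then q else 0ℚ) (x≐y i j i<j) })
                                        (Edges-ordered n))

  xOf-*ˡ : ∀ c (x : EdgeWeight n) → xOf (λ i j → c ℚ.* x i j) P ≡ c ℚ.* xOf x P
  xOf-*ˡ c x = trans (cong sumℚ (List.map-cong (λ { (i , j) → pull (P i j) }) (Edges n)))
                     (sumℚ-map-*ˡ c _ (Edges n))
    where
    pull : ∀ {q} b → (if b then c ℚ.* q else 0ℚ) ≡ c ℚ.* (if b then q else 0ℚ)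
    pull true  = refl
    pull false = sym (ℚ.*-zeroʳ c)

  xOf-∑ : ∀ {l} (f : Fin l → EdgeWeight n) → xOf (λ i j → ∑ℚ λ k → f k i j) P ≡ ∑ℚ λ k → xOf (f k) P
  xOf-∑ {l} f = trans (cong sumℚ (List.map-cong (λ { (i , j) → pull (P i j) }) (Edges n)))
                      (sumℚ-map-∑ (λ k → λ { (i , j) → if P i j then f k i j else 0ℚ }) (Edges n))
    where
    pull : ∀ {g : Fin l → ℚ} b → (if b then ∑ℚ g else 0ℚ) ≡ ∑ℚ λ k → if b then g k else 0ℚ
    pull true  = refl
    pull false = sym (ℚΣ.sum-replicate-zero l)

  xOf-fromℕ : ∀ (w : ℕWeight n) → xOf (λ i j → fromℕ (w i j)) P ≡ fromℕ (wOf w P)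
  xOf-fromℕ w = begin
    xOf (λ i j → fromℕ (w i j)) P
      ≡⟨ cong sumℚ (List.map-cong (λ { (i , j) → pull (P i j) }) (Edges n)) ⟩
    sumℚ (map (fromℕ ∘ λ { (i , j) → if P i j then w i j else 0 }) (Edges n))
      ≡⟨ sym (fromℕ-sum-map _ (Edges n)) ⟩
    fromℕ (sum (map (λ { (i , j) → if P i j then w i j else 0 }) (Edges n)))
      ≡⟨ cong fromℕ (sum-map-Edges-wOf w P) ⟩
    fromℕ (wOf w P) ∎
    where
    open ≡-Reasoning
    pull : ∀ {m} b → (if b then fromℕ m else 0ℚ) ≡ fromℕ (if b then m else 0)
    pull true  = refl
    pull false = refl

∑ℚ-mono-≤ : ∀ {l} {f g : Fin l → ℚ} → (∀ k → f k ℚ.≤ g k) → ∑ℚ f ℚ.≤ ∑ℚ g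
∑ℚ-mono-≤ {zero}  f≤g = ℚ.≤-refl
∑ℚ-mono-≤ {suc l} f≤g = ℚ.+-mono-≤ (f≤g zero) (∑ℚ-mono-≤ (f≤g ∘ suc))

∑ℚ-mono-< : ∀ {l} {f g : Fin l → ℚ} → (∀ k → f k ℚ.≤ g k) → ∀ k → f k ℚ.< g k → ∑ℚ f ℚ.< ∑ℚ g
∑ℚ-mono-< f≤g zero    fk<gk = ℚ.+-mono-<-≤ fk<gk (∑ℚ-mono-≤ (f≤g ∘ suc))
∑ℚ-mono-< f≤g (suc k) fk<gk = ℚ.+-mono-≤-< (f≤g zero) (∑ℚ-mono-< (f≤g ∘ suc) k fk<gk)

weighted-mean>1 : ∀ {l} (λs q : Fin l → ℚ) → (∀ k → 0ℚ ℚ.< λs k) → ∑ℚ λs ≡ 1ℚ →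
                  (∀ k → 1ℚ ℚ.≤ q k) → ∀ k → 1ℚ ℚ.< q k → 1ℚ ℚ.< ∑ℚ (λ k → λs k ℚ.* q k)
weighted-mean>1 λs q pos sum1 1≤q k 1<qk =
  subst (ℚ._< ∑ℚ (λ k → λs k ℚ.* q k)) sum1 (∑ℚ-mono-< λ≤λq k λ<λq)
  where
  λ≤λq : ∀ k → λs k ℚ.≤ λs k ℚ.* q k
  λ≤λq k = subst (ℚ._≤ λs k ℚ.* q k) (ℚ.*-identityʳ (λs k))
                 (ℚ.*-monoˡ-≤-nonNeg (λs k) {{ℚ.nonNegative (ℚ.<⇒≤ (pos k))}} (1≤q k))
  λ<λq : λs k ℚ.< λs k ℚ.* q k
  λ<λq = subst (ℚ._< λs k ℚ.* q k) (ℚ.*-identityʳ (λs k)) (ℚ.*-monoʳ-<-pos (λs k) {{ℚ.positive (pos k)}} 1<qk)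

χ≡fromℕ∘χℕ : ∀ {n} (A : EdgeSet n) i j → χ A i j ≡ fromℕ (χℕ A i j)
χ≡fromℕ∘χℕ A i j with A i j
... | true  = refl
... | false = refl

xOf-convex : ∀ {n} {x : EdgeWeight n} {l λs} {Js : Fin l → EdgeSet n} → ConvexTreeCombination x l λs Js →
  ∀ P → xOf x P ≡ ∑ℚ λ k → λs k ℚ.* fromℕ (wOf (χℕ (Js k)) P)
xOf-convex {x = x} {λs = λs} {Js} C P = begin
  xOf x P
    ≡⟨ xOf-cong P (λ i j i<j → trans (comb i j i<j) (foldr-map-allFin ℚ-semiring (λ k → λs k ℚ.* χ (Js k) i j))) ⟩
  xOf (λ i j → ∑ℚ λ k → λs k ℚ.* χ (Js k) i j) P
    ≡⟨ xOf-∑ P (λ k i j → λs k ℚ.* χ (Js k) i j) ⟩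
  ∑ℚ (λ k → xOf (λ i j → λs k ℚ.* χ (Js k) i j) P)
    ≡⟨ ℚΣ.sum-cong-≗ (λ k → xOf-*ˡ P (λs k) (χ (Js k))) ⟩
  ∑ℚ (λ k → λs k ℚ.* xOf (χ (Js k)) P)
    ≡⟨ ℚΣ.sum-cong-≗ (λ k → cong (λs k ℚ.*_) (trans (xOf-cong P (λ i j _ → χ≡fromℕ∘χℕ (Js k) i j))
                                                       (xOf-fromℕ P (χℕ (Js k))))) ⟩
  ∑ℚ (λ k → λs k ℚ.* fromℕ (wOf (χℕ (Js k)) P)) ∎
  where
  open ≡-Reasoning
  open ConvexTreeCombination C

halfIntegral⇒doubled : ∀ {n} {x : EdgeWeight n} → HalfIntegral x →
  Σ (ℕWeight n) λ z → ∀ i j → toℕ i < toℕ j → x i j ≡ ½ ℚ.* fromℕ (z i j)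
halfIntegral⇒doubled {n} {x} half = z , x≡½z
  where
  double : ∀ {q} → q ≡ 0ℚ ⊎ (q ≡ ½ ⊎ q ≡ 1ℚ) → Σ ℕ λ k → q ≡ ½ ℚ.* fromℕ k
  double (inj₁ q≡0)        = 0 , q≡0
  double (inj₂ (inj₁ q≡½)) = 1 , q≡½
  double (inj₂ (inj₂ q≡1)) = 2 , q≡1
  z : ℕWeight n
  z i j with toℕ i ℕ.<? toℕ j
  ... | yes i<j = proj₁ (double (half i j i<j))
  ... | no  _   = 0
  x≡½z : ∀ i j → toℕ i < toℕ j → x i j ≡ ½ ℚ.* fromℕ (z i j)
  x≡½z i j i<j with toℕ i ℕ.<? toℕ j
  ... | yes i<j′ = proj₂ (double (half i j i<j′))
  ... | no  i≮j  = contradiction i<j i≮j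

xOf-doubled : ∀ {n} {x : EdgeWeight n} {z : ℕWeight n} → (∀ i j → toℕ i < toℕ j → x i j ≡ ½ ℚ.* fromℕ (z i j)) →
  ∀ P → xOf x P ≡ ½ ℚ.* fromℕ (wOf z P)
xOf-doubled {z = z} x≡½z P = trans (xOf-cong P x≡½z) (trans (xOf-*ˡ P ½ _) (cong (½ ℚ.*_) (xOf-fromℕ P z)))

feasible⇒even-stars : ∀ {n} {s t : Fin n} {x : EdgeWeight n} {z : ℕWeight n} → FeasibleLP1 s t x →
  (∀ i j → toℕ i < toℕ j → x i j ≡ ½ ℚ.* fromℕ (z i j)) → ∀ v → parity (wδ z (singleton v)) ≡ 0ℙ
feasible⇒even-stars {s = s} {t} {x} {z} feas x≡½z v =
  trans (cong parity (½*fromℕ≡fromℕ⇒≡2* {wδ z (singleton v)} {proj₁ degree} star≡k)) (ℙ.*-homo-* 2 (proj₁ degree))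
  where
  open FeasibleLP1 feas
  degree : ∃ λ k → xδ x (singleton v) ≡ fromℕ k
  degree with v Fin.≟ s | v Fin.≟ t
  ... | yes refl | _        = 1 , deg-s
  ... | no _     | yes refl = 1 , deg-t
  ... | no v≢s   | no v≢t   = 2 , deg-v v v≢s v≢t
  star≡k : ½ ℚ.* fromℕ (wδ z (singleton v)) ≡ fromℕ (proj₁ degree)
  star≡k = trans (sym (xOf-doubled x≡½z (inδ (singleton v)))) (proj₂ degree)

halfIntegral⇒integral-cuts : ∀ {n} {s t : Fin n} {x : EdgeWeight n} → HalfIntegral x → FeasibleLP1 s t x →
  ∀ S → ∃ λ m → xδ x S ≡ fromℕ m
halfIntegral⇒integral-cuts half feas S with halfIntegral⇒doubled half
... | z , x≡½z with even⇒≡2* (wδ z S) (even-stars⇒even-cuts z (feasible⇒even-stars feas x≡½z) S)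
...   | m , zδ≡2m = m , trans (xOf-doubled x≡½z (inδ S)) (trans (cong (λ k → ½ ℚ.* fromℕ k) zδ≡2m) (½*fromℕ-2* m))

convex-crossings>1 : ∀ {n} {s t : Fin n} {x : EdgeWeight n} {l λs} {Js : Fin l → EdgeSet n} → ¬ s ≡ t →
  ConvexTreeCombination x l λs Js → ∀ k {S} → IsCut S →
  isOdd (count (S ∩ WrongDeg s t (Js k))) ≡ true → isOdd (countST S s t) ≡ true → 1ℚ ℚ.< xδ x S
convex-crossings>1 {λs = λs} {Js} s≢t C k {S} cut odd-T odd-st =
  subst (1ℚ ℚ.<_) (sym (xOf-convex C (inδ S)))
    (weighted-mean>1 λs (λ k → fromℕ (wδ (χℕ (Js k)) S)) pos (trans (sym (foldr-map-allFin ℚ-semiring λs)) sum1)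
                     (λ k → fromℕ-mono-≤ (connected-crossing≥1 (proj₁ (trees k)) cut))
                     k (fromℕ-mono-< (connected-crossings≥2 s≢t (proj₁ (trees k)) cut odd-T odd-st)))
  where open ConvexTreeCombination C

lemma13 : (n : ℕ) (s t : Fin n) → ¬ s ≡ t →
    (x : EdgeWeight n) → HalfIntegral x → FeasibleLP1 s t x →
    (l : ℕ) (λs : Fin l → ℚ) (Js : Fin l → EdgeSet n) →
    ConvexTreeCombination x l λs Js →
    (k : Fin l) →
    (S : VSet n) → IsCut S →
    isOdd (count (S ∩ WrongDeg s t (Js k))) ≡ true →
    (1ℚ ℚ.+ 1ℚ) ℚ.≤ xδ x S
lemma13 n s t s≢t x half feas l λs Js C k S cut odd-T with isOdd (countST S s t) in odd-st
... | false = FeasibleLP1.even-cut feas S cut odd-st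
... | true  = subst ((1ℚ ℚ.+ 1ℚ) ℚ.≤_) (sym xδ≡m) (fromℕ-mono-≤ 2≤m)
  where
  integral : ∃ λ m → xδ x S ≡ fromℕ m
  integral = halfIntegral⇒integral-cuts half feas S
  m : ℕ
  m = proj₁ integral
  xδ≡m : xδ x S ≡ fromℕ m
  xδ≡m = proj₂ integral
  2≤m : 2 ≤ m
  2≤m = fromℕ-cancel-< {1} {m} (subst (1ℚ ℚ.<_) xδ≡m (convex-crossings>1 s≢t C k cut odd-T odd-st))
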